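{- Let $a,b$ be relatively prime integers with $1<a<b$, let $S=\langle a,b\rangle$, and let $(u,v)$ be the definitely least solution of $ax+by=1$. Then for every $i\in[1,a-1]$ with $I_{i,a}(S)\neq\varnothing$, one has $\#I_{i,a}(S)=|u|$; i.e. each block of the partition $\{I_{i,a}(S): I_{i,a}(S)\neq\varnothing,\ i\in[1,a-1]\}$ of $I(S)$ has cardinality $|u|$.
   Context: $\langle a,b\rangle=\{\lambda_1a+\lambda_2b:\lambda_1,\lambda_2\in\mathbb{N}\}$. $I(S)$ is the set of isolated gaps of $S$ (elements $x\in\mathbb{N}\setminus S$ with $x-1,x+1\in S$). For $i\in\{1,\dots,a-1\}$, $I_{i,a}(S)=\{s\in I(S): s\equiv i\pmod a\}$. The definitely least solution $(u,v)$ of $ax+by=1$ is the integer solution for which both $|u|$ and $|v|$ are least possible; it is unique, and is the unique solution with $|u|\le b/2$, $|v|\le a/2$. -}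

module Defs where

open import Data.Nat using (ℕ; suc; _+_; _*_; _%_; _≤_; _<_; NonZero)
open import Data.Integer as ℤ using (ℤ; +_; ∣_∣)
import Data.Integer.Divisibility as ℤDiv
open import Data.Product using (_×_; ∃; ∃-syntax)
open import Relation.Nullary using (¬_)
open import Relation.Binary.PropositionalEquality using (_≡_)

InSG : ℕ → ℕ → ℕ → Set
InSG a b x = ∃[ l₁ ] ∃[ l₂ ] x ≡ l₁ * a + l₂ * b

-- x is an isolated gap of ⟨a,b⟩: x ∉ S, x-1 ∈ S, x+1 ∈ S.
-- (x-1 ∈ S forces x ≥ 1, so we write x = suc y.)
IsolatedGap : ℕ → ℕ → ℕ → Set
IsolatedGap a b x = ¬ InSG a b x × ∃[ y ] (x ≡ suc y × InSG a b y) × InSG a b (suc x)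

InI : (a b i : ℕ) → ℕ → Set
InI a b i x = IsolatedGap a b x × (+ a) ℤDiv.∣ ((+ x) ℤ.- (+ i))

IsSolution : ℕ → ℕ → ℤ → ℤ → Set
IsSolution a b u v = (+ a) ℤ.* u ℤ.+ (+ b) ℤ.* v ≡ + 1

DefinitelyLeast : ℕ → ℕ → ℤ → ℤ → Set
DefinitelyLeast a b u v =
  IsSolution a b u v ×
  (∀ x y → IsSolution a b x y → ∣ u ∣ ≤ ∣ x ∣ × ∣ v ∣ ≤ ∣ y ∣)

{-# OPTIONS --safe #-}
-- Every residue class modulo a contains a unique μ b with μ < a, and n ∈ ⟨a,b⟩ iff n ≥ μ b
-- for the μ of the class of n.  Hence x ≡ i is an isolated gap iff x < μ b, μ⁻ b < x and
-- μ⁺ b ≤ x + 1, where μ⁻, μ, μ⁺ belong to the classes of i − 1, i, i + 1.  Given one such gap,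
-- μ b = p a + μ⁻ b + 1 and μ b + 1 = q a + μ⁺ b with p, q ≥ 0, and the gaps of the class are
-- exactly μ b − k a for 1 ≤ k ≤ min(p, q).  Both (−p, μ − μ⁻) and (q, μ⁺ − μ) solve
-- a x + b y = 1; since (μ − μ⁻) + (μ − μ⁺) is a multiple of a strictly between 0 and 2a, it
-- equals a and p + q = b.  So these are the two solutions whose x lies nearest 0 on either
-- side, and |u| = min(p, q).
module Submission where

open import Defs
open import Data.Nat using (ℕ; _<_; _≤_)
open import Data.Nat.Coprimality using (Coprime)
open import Data.Integer using (ℤ; ∣_∣)
open import Data.Product using (_×_; ∃-syntax)
open import Data.List using (List; length)
open import Data.List.Membership.Propositional using (_∈_)
open import Data.List.Relation.Unary.Unique.Propositional using (Unique)
open import Relation.Binary.PropositionalEquality using (_≡_)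

open import Data.Nat.Base using (zero; suc; _+_; _*_; _∸_; _⊓_; NonZero; >-nonZero; >-nonZero⁻¹; z≤n; s≤s; z<s)
open import Data.Nat.Properties
import Data.Nat.Coprimality as ℕ
import Data.Nat.Divisibility as ℕ
open import Data.Integer.Base as ℤ using (+_; -[1+_]; 1ℤ; -1ℤ; _%ℕ_; _/ℕ_)
import Data.Integer.Properties as ℤ
open import Data.Integer.DivMod using (n%ℕd<d; a≡a%ℕn+[a/ℕn]*n)
open import Data.Integer.Divisibility.Signed using (_∣_; divides; ∣ᵤ⇒∣; ∣⇒∣ᵤ; ∣m∣n⇒∣m+n; ∣m⇒∣-m)
open import Data.Integer.Coprimality using (coprime-divisor)
open import Data.Integer.Tactic.RingSolver using (solve-∀)
open import Data.List using (applyUpTo)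
open import Data.List.Properties using (length-applyUpTo)
open import Data.List.Membership.Propositional.Properties using (∈-applyUpTo⁺; ∈-applyUpTo⁻)
open import Data.List.Relation.Unary.Unique.Propositional.Properties using (applyUpTo⁺₁)
open import Data.Product using (_,_; proj₁; proj₂)
open import Data.Sum using (inj₁; inj₂)
open import Data.Empty using (⊥-elim)
open import Function.Base using (_∘_)
open import Function.Bundles using (_⇔_; mk⇔; Equivalence)
import Function.Properties.Equivalence as ⇔
open import Relation.Binary.PropositionalEquality
  using (refl; sym; trans; cong; cong₂; subst; subst₂; module ≡-Reasoning)

open Equivalence using (to; from)

private variable
  a b c j k m n x y : ℕ
  s t u v w s′ t′ : ℤ

infix 4 _≡_mod_

-- A record rather than a synonym, so that s and t can be inferred from the type.
record _≡_mod_ (s t : ℤ) (a : ℕ) : Set where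
  constructor mod-divides
  field divides-difference : + a ∣ s ℤ.- t

≡mod-sym : s ≡ t mod a → t ≡ s mod a
≡mod-sym {s} {t} {a} (mod-divides a∣s-t) = mod-divides (subst (+ a ∣_) (neg-difference s t) (∣m⇒∣-m a∣s-t))
  where
  neg-difference : ∀ s t → ℤ.- (s ℤ.- t) ≡ t ℤ.- s
  neg-difference = solve-∀

≡mod-trans : s ≡ t mod a → t ≡ w mod a → s ≡ w mod a
≡mod-trans {s} {t} {a} {w} (mod-divides a∣s-t) (mod-divides a∣t-w) =
  mod-divides (subst (+ a ∣_) (telescope s t w) (∣m∣n⇒∣m+n a∣s-t a∣t-w))
  where
  telescope : ∀ s t w → (s ℤ.- t) ℤ.+ (t ℤ.- w) ≡ s ℤ.- w
  telescope = solve-∀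

≡mod-+ˡ : ∀ w → s ≡ t mod a → w ℤ.+ s ≡ w ℤ.+ t mod a
≡mod-+ˡ {s} {t} {a} w (mod-divides a∣s-t) = mod-divides (subst (+ a ∣_) (difference w s t) a∣s-t)
  where
  difference : ∀ w s t → s ℤ.- t ≡ (w ℤ.+ s) ℤ.- (w ℤ.+ t)
  difference = solve-∀

≡mod-neg : s ≡ t mod a → ℤ.- s ≡ ℤ.- t mod a
≡mod-neg {s} {t} {a} (mod-divides a∣s-t) = mod-divides (subst (+ a ∣_) (difference s t) (∣m⇒∣-m a∣s-t))
  where
  difference : ∀ s t → ℤ.- (s ℤ.- t) ≡ ℤ.- s ℤ.- ℤ.- t
  difference = solve-∀

*-cancelʳ-≡mod : Coprime a b → s ℤ.* + b ≡ t ℤ.* + b mod a → s ≡ t mod a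
*-cancelʳ-≡mod {a} {b} {s} {t} coprime (mod-divides a∣sb-tb) = mod-divides (∣ᵤ⇒∣
  (coprime-divisor (+ a) (+ b) (s ℤ.- t) coprime (∣⇒∣ᵤ (subst (+ a ∣_) (factor s t (+ b)) a∣sb-tb))))
  where
  factor : ∀ s t b → s ℤ.* b ℤ.- t ℤ.* b ≡ b ℤ.* (s ℤ.- t)
  factor = solve-∀

k*a+n≡n-mod : ∀ k n → + (k * a + n) ≡ + n mod a
k*a+n≡n-mod {a} k n = mod-divides (divides (+ k) (begin
  + (k * a + n) ℤ.- + n         ≡⟨ cong (ℤ._- + n) (ℤ.pos-+ (k * a) n) ⟩
  + (k * a) ℤ.+ + n ℤ.- + n     ≡⟨ cancel (+ (k * a)) (+ n) ⟩
  + (k * a)                     ≡⟨ ℤ.pos-* k a ⟩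
  + k ℤ.* + a                   ∎))
  where
  open ≡-Reasoning
  cancel : ∀ s t → s ℤ.+ t ℤ.- t ≡ s
  cancel = solve-∀

≡mod⇒∃k*a+ : n ≤ m → + m ≡ + n mod a → ∃[ k ] m ≡ k * a + n
≡mod⇒∃k*a+ {n} {m} {a} n≤m (mod-divides a∣m-n)
  with ℕ.divides k m∸n≡ka ← ∣⇒∣ᵤ (subst (+ a ∣_) (trans (ℤ.[+m]-[+n]≡m⊖n m n) (ℤ.⊖-≥ n≤m)) a∣m-n)
  = k , trans (sym (m∸n+n≡m n≤m)) (cong (_+ n) m∸n≡ka)

≡mod∧<⇒≤ : + m ≡ + n mod a → n < a → n ≤ m
≡mod∧<⇒≤ {m} {n} {a} m≡n n<a with ≤-total n m
... | inj₁ n≤m = n≤m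
... | inj₂ m≤n with ≡mod⇒∃k*a+ m≤n (≡mod-sym m≡n)
...   | zero  , n≡m = ≤-reflexive n≡m
...   | suc k , n≡ = ⊥-elim (<⇒≱ n<a (subst (a ≤_) (sym n≡) (≤-trans (m≤m+n a (k * a)) (m≤m+n (suc k * a) m))))

opaque
  aperyIndex : (a : ℕ) .{{_ : NonZero a}} → ℤ → ℤ → ℕ
  aperyIndex a v n = (n ℤ.* v) %ℕ a

  aperyIndex<a : .{{_ : NonZero a}} → ∀ v n → aperyIndex a v n < a
  aperyIndex<a {a} v n = n%ℕd<d (n ℤ.* v) a

  ≡aperyIndex*b : .{{_ : NonZero a}} → IsSolution a b u v → ∀ n → n ≡ + (aperyIndex a v n * b) mod a
  ≡aperyIndex*b {a} {b} {u} {v} sol n = mod-divides (divides (n ℤ.* u ℤ.+ Q ℤ.* B) (begin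
    n ℤ.- + (μ * b)                                  ≡⟨ cong₂ ℤ._-_ (sym (ℤ.*-identityʳ n)) (ℤ.pos-* μ b) ⟩
    n ℤ.* 1ℤ ℤ.- M ℤ.* B                             ≡⟨ cong (λ one → n ℤ.* one ℤ.- M ℤ.* B) sol ⟨
    n ℤ.* (A ℤ.* u ℤ.+ B ℤ.* v) ℤ.- M ℤ.* B          ≡⟨ distribute n u v A B M ⟩
    (n ℤ.* u) ℤ.* A ℤ.+ (n ℤ.* v) ℤ.* B ℤ.- M ℤ.* B  ≡⟨ cong (λ nv → (n ℤ.* u) ℤ.* A ℤ.+ nv ℤ.* B ℤ.- M ℤ.* B)
                                                           (a≡a%ℕn+[a/ℕn]*n (n ℤ.* v) a) ⟩
    (n ℤ.* u) ℤ.* A ℤ.+ (M ℤ.+ Q ℤ.* A) ℤ.* B ℤ.- M ℤ.* B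
                                                     ≡⟨ collect (n ℤ.* u) M Q A B ⟩
    (n ℤ.* u ℤ.+ Q ℤ.* B) ℤ.* A                      ∎))
    where
    open ≡-Reasoning
    μ : ℕ
    μ = aperyIndex a v n
    A B M Q : ℤ
    A = + a
    B = + b
    M = + μ
    Q = (n ℤ.* v) /ℕ a
    distribute : ∀ n u v A B M →
      n ℤ.* (A ℤ.* u ℤ.+ B ℤ.* v) ℤ.- M ℤ.* B ≡ (n ℤ.* u) ℤ.* A ℤ.+ (n ℤ.* v) ℤ.* B ℤ.- M ℤ.* B
    distribute = solve-∀
    collect : ∀ w M Q A B → w ℤ.* A ℤ.+ (M ℤ.+ Q ℤ.* A) ℤ.* B ℤ.- M ℤ.* B ≡ (w ℤ.+ Q ℤ.* B) ℤ.* A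
    collect = solve-∀

module _ {a b : ℕ} (coprime : Coprime a b) where

  InSG⇒m*b≤ : m < a → + n ≡ + (m * b) mod a → InSG a b n → m * b ≤ n
  InSG⇒m*b≤ {m} m<a n≡mb (l₁ , l₂ , refl) = ≤-trans (*-monoˡ-≤ b m≤l₂) (m≤n+m (l₂ * b) (l₁ * a))
    where
    l₂b≡mb : + (l₂ * b) ≡ + (m * b) mod a
    l₂b≡mb = ≡mod-trans (≡mod-sym (k*a+n≡n-mod l₁ (l₂ * b))) n≡mb
    m≤l₂ : m ≤ l₂
    m≤l₂ = ≡mod∧<⇒≤ (*-cancelʳ-≡mod coprime (subst₂ (λ s t → s ≡ t mod a) (ℤ.pos-* l₂ b) (ℤ.pos-* m b) l₂b≡mb)) m<a

  InSG⇔m*b≤ : m < a → + n ≡ + (m * b) mod a → InSG a b n ⇔ m * b ≤ n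
  InSG⇔m*b≤ {m} m<a n≡mb = mk⇔ (InSG⇒m*b≤ m<a n≡mb) λ mb≤n →
    let k , n≡ka+mb = ≡mod⇒∃k*a+ mb≤n n≡mb in k , m , n≡ka+mb

j*a+x≡k*a+c⇒c≤x⇔j≤k : .{{_ : NonZero a}} → j * a + x ≡ k * a + c → c ≤ x ⇔ j ≤ k
j*a+x≡k*a+c⇒c≤x⇔j≤k {a} {j} {x} {k} {c} eq = mk⇔
  (λ c≤x → *-cancelʳ-≤ j k a (+-cancelʳ-≤ c (j * a) (k * a) (begin
    j * a + c ≤⟨ +-monoʳ-≤ (j * a) c≤x ⟩
    j * a + x ≡⟨ eq ⟩
    k * a + c ∎)))
  (λ j≤k → +-cancelˡ-≤ (j * a) c x (begin
    j * a + c ≤⟨ +-monoˡ-≤ c (*-monoˡ-≤ a j≤k) ⟩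
    k * a + c ≡⟨ eq ⟨
    j * a + x ∎))
  where open ≤-Reasoning

progressionBelow : ℕ → ℕ → ℕ → List ℕ
progressionBelow a N m = applyUpTo (λ k → N ∸ suc k * a) m

∈-progressionBelow⇔ : ∀ {N} → m * a ≤ N → x ∈ progressionBelow a N m ⇔ (∃[ k ] k < m × suc k * a + x ≡ N)
∈-progressionBelow⇔ {m} {a} {x} {N} ma≤N = mk⇔
  (λ x∈ → let k , k<m , x≡ = ∈-applyUpTo⁻ _ x∈ in
    k , k<m , trans (cong (_+_ (suc k * a)) x≡) (m+[n∸m]≡n (step≤N k<m)))
  (λ (k , k<m , eq) → subst (_∈ _) (trans (cong (_∸ suc k * a) (sym eq)) (m+n∸m≡n (suc k * a) x))
    (∈-applyUpTo⁺ _ k<m))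
  where
  step≤N : k < m → suc k * a ≤ N
  step≤N k<m = ≤-trans (*-monoˡ-≤ a k<m) ma≤N

progressionBelow-unique : .{{_ : NonZero a}} → ∀ {N} → m * a ≤ N → Unique (progressionBelow a N m)
progressionBelow-unique {a} {m} {N} ma≤N = applyUpTo⁺₁ _ m λ {k} {l} k<l l<m eq →
  <⇒≢ k<l (suc-injective (*-cancelʳ-≡ (suc k) (suc l) a (∸-cancelˡ-≡ (step≤N (<-trans k<l l<m)) (step≤N l<m) eq)))
  where
  step≤N : k < m → suc k * a ≤ N
  step≤N k<m = ≤-trans (*-monoˡ-≤ a k<m) ma≤N

m∣n∧0<n<m+m⇒n≡m : a ℕ.∣ n → 0 < n → n < a + a → n ≡ a
m∣n∧0<n<m+m⇒n≡m {a} (ℕ.divides 1 refl) _ _ = +-identityʳ a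
m∣n∧0<n<m+m⇒n≡m {a} (ℕ.divides (suc (suc k)) refl) _ n<a+a =
  ⊥-elim (<⇒≱ n<a+a (+-monoʳ-≤ a (m≤m+n a (k * a))))

db≡1+pa⇒IsSolution : ∀ {a b d p} → d * b ≡ 1 + p * a → IsSolution a b (ℤ.- + p) (+ d)
db≡1+pa⇒IsSolution {a} {b} {d} {p} db≡ = begin
  + a ℤ.* ℤ.- + p ℤ.+ + b ℤ.* + d  ≡⟨ rearrange (+ a) (+ b) (+ p) (+ d) ⟩
  + d ℤ.* + b ℤ.- + p ℤ.* + a      ≡⟨ cong₂ ℤ._-_ (ℤ.pos-* d b) (ℤ.pos-* p a) ⟨
  + (d * b) ℤ.- + (p * a)          ≡⟨ cong (λ db → + db ℤ.- + (p * a)) db≡ ⟩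
  1ℤ ℤ.+ + (p * a) ℤ.- + (p * a)   ≡⟨ cancel 1ℤ (+ (p * a)) ⟩
  1ℤ                               ∎
  where
  open ≡-Reasoning
  rearrange : ∀ a b p d → a ℤ.* ℤ.- p ℤ.+ b ℤ.* d ≡ d ℤ.* b ℤ.- p ℤ.* a
  rearrange = solve-∀
  cancel : ∀ s t → s ℤ.+ t ℤ.- t ≡ s
  cancel = solve-∀

1+eb≡qa⇒IsSolution : ∀ {a b e q} → 1 + e * b ≡ q * a → IsSolution a b (+ q) (ℤ.- + e)
1+eb≡qa⇒IsSolution {a} {b} {e} {q} eb≡ = begin
  + a ℤ.* + q ℤ.+ + b ℤ.* ℤ.- + e  ≡⟨ rearrange (+ a) (+ b) (+ q) (+ e) ⟩
  + q ℤ.* + a ℤ.- + e ℤ.* + b      ≡⟨ cong₂ ℤ._-_ (ℤ.pos-* q a) (ℤ.pos-* e b) ⟨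
  + (q * a) ℤ.- + (e * b)          ≡⟨ cong (λ qa → + qa ℤ.- + (e * b)) eb≡ ⟨
  1ℤ ℤ.+ + (e * b) ℤ.- + (e * b)   ≡⟨ cancel 1ℤ (+ (e * b)) ⟩
  1ℤ                               ∎
  where
  open ≡-Reasoning
  rearrange : ∀ a b q e → a ℤ.* q ℤ.+ b ℤ.* ℤ.- e ≡ q ℤ.* a ℤ.- e ℤ.* b
  rearrange = solve-∀
  cancel : ∀ s t → s ℤ.+ t ℤ.- t ≡ s
  cancel = solve-∀

≡-p-mod-p+q⇒p⊓q≤∣w∣ : ∀ {p q} w → w ≡ ℤ.- + p mod p + q → p ⊓ q ≤ ∣ w ∣
≡-p-mod-p+q⇒p⊓q≤∣w∣ {zero} (+ n) _ = z≤n
≡-p-mod-p+q⇒p⊓q≤∣w∣ {suc p} {q} (+ n) n≡-p =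
  ≤-trans (m⊓n≤n (suc p) q) (≡mod∧<⇒≤ (≡mod-trans n≡-p -p≡q) (m<n+m q z<s))
  where
  -p≡q : ℤ.- + suc p ≡ + q mod suc p + q
  -p≡q = mod-divides (divides -1ℤ (trans (regroup (+ suc p) (+ q)) (cong (-1ℤ ℤ.*_) (sym (ℤ.pos-+ (suc p) q)))))
    where
    regroup : ∀ p q → ℤ.- p ℤ.- q ≡ -1ℤ ℤ.* (p ℤ.+ q)
    regroup = solve-∀
≡-p-mod-p+q⇒p⊓q≤∣w∣ {p} {zero} -[1+ n ] _ = ≤-trans (m⊓n≤n p 0) z≤n
≡-p-mod-p+q⇒p⊓q≤∣w∣ {p} {suc q} -[1+ n ] w≡-p =
  ≤-trans (m⊓n≤m p (suc q)) (≡mod∧<⇒≤ 1+n≡p (m<m+n p z<s))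
  where
  1+n≡p : + suc n ≡ + p mod p + suc q
  1+n≡p = subst (+ suc n ≡_mod p + suc q) (ℤ.neg-involutive (+ p)) (≡mod-neg w≡-p)

module _ {a b : ℕ} .{{_ : NonZero a}} (coprime : Coprime a b) where

  quotients-sum≡b : ∀ {d e p q} → d * b ≡ 1 + p * a → 1 + e * b ≡ q * a → d < a → e < a → p + q ≡ b
  quotients-sum≡b {d} {e} {p} {q} db≡ eb≡ d<a e<a =
    *-cancelʳ-≡ (p + q) b a (trans (sym sum) (trans (cong (_* b) d+e≡a) (*-comm a b)))
    where
    open ≡-Reasoning
    sum : (d + e) * b ≡ (p + q) * a
    sum = suc-injective (begin
      1 + (d + e) * b      ≡⟨ cong suc (*-distribʳ-+ b d e) ⟩
      1 + (d * b + e * b)  ≡⟨ +-suc (d * b) (e * b) ⟨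
      d * b + (1 + e * b)  ≡⟨ cong₂ _+_ db≡ eb≡ ⟩
      1 + p * a + q * a    ≡⟨ cong suc (*-distribʳ-+ a p q) ⟨
      1 + (p + q) * a      ∎)
    0<d : 0 < d
    0<d = *-cancelʳ-< b 0 d (subst (0 <_) (sym db≡) z<s)
    d+e≡a : d + e ≡ a
    d+e≡a = m∣n∧0<n<m+m⇒n≡m (ℕ.coprime-divisor coprime (ℕ.divides (p + q) (trans (*-comm b (d + e)) sum)))
      (<-≤-trans 0<d (m≤m+n d e)) (+-mono-< d<a e<a)

  solutions-≡mod : IsSolution a b s t → IsSolution a b s′ t′ → s ≡ s′ mod b
  solutions-≡mod {s} {t} {s′} {t′} sol sol′ =
    *-cancelʳ-≡mod (ℕ.sym coprime) (mod-divides (divides (t′ ℤ.- t) (begin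
      s ℤ.* A ℤ.- s′ ℤ.* A                               ≡⟨ regroup s t s′ t′ A B ⟩
      (A ℤ.* s ℤ.+ B ℤ.* t) ℤ.- (A ℤ.* s′ ℤ.+ B ℤ.* t′)
        ℤ.+ (t′ ℤ.- t) ℤ.* B                             ≡⟨ cong₂ (λ x y → x ℤ.- y ℤ.+ (t′ ℤ.- t) ℤ.* B) sol sol′ ⟩
      1ℤ ℤ.- 1ℤ ℤ.+ (t′ ℤ.- t) ℤ.* B                     ≡⟨ ℤ.+-identityˡ _ ⟩
      (t′ ℤ.- t) ℤ.* B                                   ∎)))
    where
    open ≡-Reasoning
    A B : ℤ
    A = + a
    B = + b
    regroup : ∀ s t s′ t′ A B →
      s ℤ.* A ℤ.- s′ ℤ.* A ≡ (A ℤ.* s ℤ.+ B ℤ.* t) ℤ.- (A ℤ.* s′ ℤ.+ B ℤ.* t′) ℤ.+ (t′ ℤ.- t) ℤ.* B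
    regroup = solve-∀

  DefinitelyLeast⇒∣u∣≡p⊓q : ∀ {d e p q} → DefinitelyLeast a b u v →
    d * b ≡ 1 + p * a → 1 + e * b ≡ q * a → d < a → e < a → ∣ u ∣ ≡ p ⊓ q
  DefinitelyLeast⇒∣u∣≡p⊓q {u} {v} {d} {e} {p} {q} (sol , least) db≡ eb≡ d<a e<a =
    ≤-antisym (⊓-glb ∣u∣≤p ∣u∣≤q) p⊓q≤∣u∣
    where
    sol⁻ : IsSolution a b (ℤ.- + p) (+ d)
    sol⁻ = db≡1+pa⇒IsSolution {a} {b} {d} {p} db≡
    ∣u∣≤p : ∣ u ∣ ≤ p
    ∣u∣≤p = subst (∣ u ∣ ≤_) (ℤ.∣-i∣≡∣i∣ (+ p)) (proj₁ (least _ _ sol⁻))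
    ∣u∣≤q : ∣ u ∣ ≤ q
    ∣u∣≤q = proj₁ (least _ _ (1+eb≡qa⇒IsSolution {a} {b} {e} {q} eb≡))
    p⊓q≤∣u∣ : p ⊓ q ≤ ∣ u ∣
    p⊓q≤∣u∣ = ≡-p-mod-p+q⇒p⊓q≤∣w∣ u
      (subst (u ≡ ℤ.- + p mod_) (sym (quotients-sum≡b {d} {e} {p} {q} db≡ eb≡ d<a e<a)) (solutions-≡mod sol sol⁻))

module ResidueClass {a b : ℕ} .{{_ : NonZero a}} {u v : ℤ}
  (coprime : Coprime a b) (sol : IsSolution a b u v) (i : ℕ) where

  μ⁻ μ μ⁺ : ℕ
  μ⁻ = aperyIndex a v (ℤ.pred (+ i))
  μ  = aperyIndex a v (+ i)
  μ⁺ = aperyIndex a v (ℤ.suc (+ i))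

  ≡μb : ∀ n → n ≡ + (aperyIndex a v n * b) mod a
  ≡μb = ≡aperyIndex*b {b = b} sol

  μ<a : μ < a
  μ<a = aperyIndex<a v (+ i)

  i≡μb : + i ≡ + (μ * b) mod a
  i≡μb = ≡μb (+ i)

  InSG⇔μb≤x : + x ≡ + i mod a → InSG a b x ⇔ μ * b ≤ x
  InSG⇔μb≤x x≡i = InSG⇔m*b≤ coprime μ<a (≡mod-trans x≡i i≡μb)

  InSG⇔μ⁻b≤y : + suc y ≡ + i mod a → InSG a b y ⇔ μ⁻ * b ≤ y
  InSG⇔μ⁻b≤y 1+y≡i =
    InSG⇔m*b≤ coprime (aperyIndex<a v (ℤ.pred (+ i))) (≡mod-trans (≡mod-+ˡ -1ℤ 1+y≡i) (≡μb (ℤ.pred (+ i))))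

  InSG⇔μ⁺b≤1+x : + x ≡ + i mod a → InSG a b (suc x) ⇔ μ⁺ * b ≤ suc x
  InSG⇔μ⁺b≤1+x x≡i =
    InSG⇔m*b≤ coprime (aperyIndex<a v (ℤ.suc (+ i))) (≡mod-trans (≡mod-+ˡ 1ℤ x≡i) (≡μb (ℤ.suc (+ i))))

  IsolatedGap⇒bounds : + x ≡ + i mod a → IsolatedGap a b x → x < μ * b × μ⁻ * b < x × μ⁺ * b ≤ suc x
  IsolatedGap⇒bounds x≡i (x∉S , y , (refl , y∈S) , 1+x∈S) =
    ≰⇒> (x∉S ∘ from (InSG⇔μb≤x x≡i)) , s≤s (to (InSG⇔μ⁻b≤y x≡i) y∈S) , to (InSG⇔μ⁺b≤1+x x≡i) 1+x∈S

  bounds⇒IsolatedGap : + x ≡ + i mod a → x < μ * b → μ⁻ * b < x → μ⁺ * b ≤ suc x → IsolatedGap a b x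
  bounds⇒IsolatedGap x≡i x<μb (s≤s μ⁻b≤y) μ⁺b≤1+x =
    <⇒≱ x<μb ∘ to (InSG⇔μb≤x x≡i) , _ , (refl , from (InSG⇔μ⁻b≤y x≡i) μ⁻b≤y) , from (InSG⇔μ⁺b≤1+x x≡i) μ⁺b≤1+x

  module Inhabited {x₀ : ℕ} (x₀≡i : + x₀ ≡ + i mod a) (gap₀ : IsolatedGap a b x₀) where

    private
      bounds₀ : x₀ < μ * b × μ⁻ * b < x₀ × μ⁺ * b ≤ suc x₀
      bounds₀ = IsolatedGap⇒bounds x₀≡i gap₀

    μ⁻b<μb : μ⁻ * b < μ * b
    μ⁻b<μb = <-trans (proj₁ (proj₂ bounds₀)) (proj₁ bounds₀)

    μ⁺b≤μb : μ⁺ * b ≤ μ * b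
    μ⁺b≤μb = ≤-trans (proj₂ (proj₂ bounds₀)) (proj₁ bounds₀)

    μb≡1+μ⁻b : + (μ * b) ≡ + suc (μ⁻ * b) mod a
    μb≡1+μ⁻b = ≡mod-trans (≡mod-sym i≡μb)
      (subst (_≡ + suc (μ⁻ * b) mod a) (ℤ.suc-pred (+ i)) (≡mod-+ˡ 1ℤ (≡μb (ℤ.pred (+ i)))))

    1+μb≡μ⁺b : + suc (μ * b) ≡ + (μ⁺ * b) mod a
    1+μb≡μ⁺b = ≡mod-trans (≡mod-+ˡ 1ℤ (≡mod-sym i≡μb)) (≡μb (ℤ.suc (+ i)))

    -- Opaque: unfolding the quotients extracted from a divisibility proof makes unification explode.
    opaque
      p q : ℕ
      p = proj₁ (≡mod⇒∃k*a+ μ⁻b<μb μb≡1+μ⁻b)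
      q = proj₁ (≡mod⇒∃k*a+ (m≤n⇒m≤1+n μ⁺b≤μb) 1+μb≡μ⁺b)

      μb≡pa+1+μ⁻b : μ * b ≡ p * a + suc (μ⁻ * b)
      μb≡pa+1+μ⁻b = proj₂ (≡mod⇒∃k*a+ μ⁻b<μb μb≡1+μ⁻b)

      1+μb≡qa+μ⁺b : suc (μ * b) ≡ q * a + μ⁺ * b
      1+μb≡qa+μ⁺b = proj₂ (≡mod⇒∃k*a+ (m≤n⇒m≤1+n μ⁺b≤μb) 1+μb≡μ⁺b)

    IsolatedGap⇒∃ : + x ≡ + i mod a → IsolatedGap a b x → ∃[ k ] k < p ⊓ q × suc k * a + x ≡ μ * b
    IsolatedGap⇒∃ {x} x≡i gap = fromQuotient (≡mod⇒∃k*a+ (<⇒≤ x<μb) (≡mod-sym (≡mod-trans x≡i i≡μb)))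
      where
      bounds : x < μ * b × μ⁻ * b < x × μ⁺ * b ≤ suc x
      bounds = IsolatedGap⇒bounds x≡i gap
      x<μb : x < μ * b
      x<μb = proj₁ bounds
      fromQuotient : ∃[ j ] μ * b ≡ j * a + x → ∃[ k ] k < p ⊓ q × suc k * a + x ≡ μ * b
      fromQuotient (zero  , μb≡x) = ⊥-elim (<⇒≢ x<μb (sym μb≡x))
      fromQuotient (suc k , μb≡)  = k , ⊓-glb k<p k<q , sym μb≡
        where
        k<p : k < p
        k<p = to (j*a+x≡k*a+c⇒c≤x⇔j≤k (trans (sym μb≡) μb≡pa+1+μ⁻b)) (proj₁ (proj₂ bounds))
        k<q : k < q
        k<q = to (j*a+x≡k*a+c⇒c≤x⇔j≤k (trans (+-suc (suc k * a) x) (trans (cong suc (sym μb≡)) 1+μb≡qa+μ⁺b)))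
          (proj₂ (proj₂ bounds))

    ∃⇒InI : ∃[ k ] k < p ⊓ q × suc k * a + x ≡ μ * b → InI a b i x
    ∃⇒InI {x} (k , k<p⊓q , eq) =
      bounds⇒IsolatedGap x≡i x<μb μ⁻b<x μ⁺b≤1+x , ∣⇒∣ᵤ (_≡_mod_.divides-difference x≡i)
      where
      x≡i : + x ≡ + i mod a
      x≡i = ≡mod-trans (≡mod-sym (subst (λ n → + n ≡ + x mod a) eq (k*a+n≡n-mod (suc k) x))) (≡mod-sym i≡μb)
      x<μb : x < μ * b
      x<μb = subst (x <_) eq (m<n+m x (<-≤-trans (>-nonZero⁻¹ a) (m≤m+n a (k * a))))
      μ⁻b<x : μ⁻ * b < x
      μ⁻b<x = from (j*a+x≡k*a+c⇒c≤x⇔j≤k (trans eq μb≡pa+1+μ⁻b)) (≤-trans k<p⊓q (m⊓n≤m p q))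
      μ⁺b≤1+x : μ⁺ * b ≤ suc x
      μ⁺b≤1+x = from (j*a+x≡k*a+c⇒c≤x⇔j≤k (trans (+-suc (suc k * a) x) (trans (cong suc eq) 1+μb≡qa+μ⁺b)))
        (≤-trans k<p⊓q (m⊓n≤n p q))

    InI⇔∃ : InI a b i x ⇔ (∃[ k ] k < p ⊓ q × suc k * a + x ≡ μ * b)
    InI⇔∃ = mk⇔ (λ (gap , a∣x-i) → IsolatedGap⇒∃ (mod-divides (∣ᵤ⇒∣ a∣x-i)) gap) ∃⇒InI

    p⊓q*a≤μb : p ⊓ q * a ≤ μ * b
    p⊓q*a≤μb = ≤-trans (*-monoˡ-≤ a (m⊓n≤m p q)) (subst (p * a ≤_) (sym μb≡pa+1+μ⁻b) (m≤m+n (p * a) _))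

    ∣u∣≡p⊓q : DefinitelyLeast a b u v → ∣ u ∣ ≡ p ⊓ q
    ∣u∣≡p⊓q least = DefinitelyLeast⇒∣u∣≡p⊓q coprime least [μ∸μ⁻]b≡1+pa 1+[μ∸μ⁺]b≡qa
      (≤-<-trans (m∸n≤m μ μ⁻) μ<a) (≤-<-trans (m∸n≤m μ μ⁺) μ<a)
      where
      open ≡-Reasoning
      [μ∸μ⁻]b≡1+pa : (μ ∸ μ⁻) * b ≡ 1 + p * a
      [μ∸μ⁻]b≡1+pa = begin
        (μ ∸ μ⁻) * b                   ≡⟨ *-distribʳ-∸ b μ μ⁻ ⟩
        μ * b ∸ μ⁻ * b                 ≡⟨ cong (_∸ μ⁻ * b) (trans μb≡pa+1+μ⁻b (+-suc (p * a) (μ⁻ * b))) ⟩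
        suc (p * a + μ⁻ * b) ∸ μ⁻ * b  ≡⟨ m+n∸n≡m (suc (p * a)) (μ⁻ * b) ⟩
        1 + p * a                      ∎
      1+[μ∸μ⁺]b≡qa : 1 + (μ ∸ μ⁺) * b ≡ q * a
      1+[μ∸μ⁺]b≡qa = begin
        1 + (μ ∸ μ⁺) * b               ≡⟨ cong suc (*-distribʳ-∸ b μ μ⁺) ⟩
        1 + (μ * b ∸ μ⁺ * b)           ≡⟨ +-∸-assoc 1 μ⁺b≤μb ⟨
        1 + μ * b ∸ μ⁺ * b             ≡⟨ cong (_∸ μ⁺ * b) 1+μb≡qa+μ⁺b ⟩
        q * a + μ⁺ * b ∸ μ⁺ * b        ≡⟨ m+n∸n≡m (q * a) (μ⁺ * b) ⟩
        q * a                          ∎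

proposition3p11 : (a b : ℕ) → 1 < a → a < b → Coprime a b →
    (u v : ℤ) → DefinitelyLeast a b u v →
    (i : ℕ) → 1 ≤ i → i < a →
    (∃[ x ] InI a b i x) →
    ∃[ L ] (Unique L ×
      (∀ x → (x ∈ L → InI a b i x) ×
             (InI a b i x → x ∈ L)) ×
      length {A = ℕ} L ≡ ∣ u ∣)
proposition3p11 a b 1<a _ coprime u v least i _ _ (x₀ , gap₀ , a∣x₀-i) =
  progressionBelow a (μ * b) (p ⊓ q) ,
  progressionBelow-unique p⊓q*a≤μb ,
  (λ x → let ∈⇔InI = ⇔.trans (∈-progressionBelow⇔ p⊓q*a≤μb) (⇔.sym InI⇔∃) in to ∈⇔InI , from ∈⇔InI) ,
  trans (length-applyUpTo _ (p ⊓ q)) (sym (∣u∣≡p⊓q least))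
  where
  instance
    a-nonZero : NonZero a
    a-nonZero = >-nonZero (<-trans z<s 1<a)
  open ResidueClass coprime (proj₁ least) i
  open Inhabited (mod-divides (∣ᵤ⇒∣ a∣x₀-i)) gap₀
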